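{- For all integers $n,L,f\ge 1$ with $(L/f)^{f+1}\le n$, there exists an $n$-vertex weighted graph $G^*=(V,E,w)$ such that every $(L,f)$-replacement path covering of $G^*$ has covering value $\Omega((L/f)^f)$.
   Context: For a (possibly weighted) graph $G=(V,E)$, $s,t\in V$ and $F\subseteq E$, a replacement path $P(s,t,F)$ is a shortest $s$-$t$ path in $G\setminus F$. A subgraph $G'\subseteq G$ covers $P(s,t,F)$ if $P(s,t,F)\subseteq G'$ and $F\cap E(G')=\emptyset$. A collection $\mathcal{G}$ of subgraphs of $G$ is an $(L,f)$-replacement path covering if for every $s,t\in V$ and every $F\subseteq E$ with $|F|\le f$, each replacement path $P(s,t,F)$ with at most $L$ edges is covered by some subgraph in $\mathcal{G}$ (if there are several $s$-$t$ shortest paths in $G\setminus F$ with at most $L$ edges, it suffices to cover one of them). Its covering value is $|\mathcal{G}|$. -}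

module Defs where

open import Data.Nat using (ℕ; zero; suc; _+_; _*_; _^_; _≤_)
open import Data.Fin using (Fin)
open import Data.Product using (_×_; _,_; Σ; ∃; ∃-syntax; proj₁; proj₂)
open import Data.Sum using (_⊎_)
open import Data.List using (List; []; _∷_; length)
open import Data.List.Relation.Unary.All using (All)
open import Data.List.Relation.Unary.Any using (Any)
open import Relation.Nullary using (¬_)
open import Relation.Binary.PropositionalEquality using (_≡_)

record WGraph (n : ℕ) : Set₁ where
  field
    Adj        : Fin n → Fin n → Set
    w          : Fin n → Fin n → ℕ
    Adj-sym    : ∀ {u v} → Adj u v → Adj v u
    Adj-irrefl : ∀ {u} → ¬ Adj u u
    w-sym      : ∀ u v → w u v ≡ w v u
    w-pos      : ∀ {u v} → Adj u v → 1 ≤ w u v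
open WGraph public

-- An (unordered) edge given by its two endpoints.
Edge : ℕ → Set
Edge n = Fin n × Fin n

SameEdge : ∀ {n} → Edge n → Edge n → Set
SameEdge (u , v) (x , y) = ((u ≡ x) × (v ≡ y)) ⊎ ((u ≡ y) × (v ≡ x))

_∈ᴱ_ : ∀ {n} → Edge n → List (Edge n) → Set
e ∈ᴱ F = Any (SameEdge e) F

data Walk {n : ℕ} (G : WGraph n) : Fin n → Fin n → Set where
  []   : ∀ {u} → Walk G u u
  step : ∀ {t} (u v : Fin n) → Adj G u v → Walk G v t → Walk G u t

edges : ∀ {n} {G : WGraph n} {s t} → Walk G s t → List (Edge n)
edges []              = []
edges (step u v _ P)  = (u , v) ∷ edges P

len : ∀ {n} {G : WGraph n} {s t} → Walk G s t → ℕ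
len []             = 0
len (step _ _ _ P) = suc (len P)

weight : ∀ {n} {G : WGraph n} {s t} → Walk G s t → ℕ
weight {G = G} []             = 0
weight {G = G} (step u v _ P) = w G u v + weight P

Avoids : ∀ {n} {G : WGraph n} {s t} → List (Edge n) → Walk G s t → Set
Avoids F P = All (λ e → ¬ (e ∈ᴱ F)) (edges P)

IsReplacementPath : ∀ {n} (G : WGraph n) (s t : Fin n) (F : List (Edge n)) → Walk G s t → Set
IsReplacementPath G s t F P =
  Avoids F P × (∀ (Q : Walk G s t) → Avoids F Q → weight P ≤ weight Q)

record Subgraph {n : ℕ} (G : WGraph n) : Set₁ where
  field
    Has : Fin n → Fin n → Set
    sub : ∀ {u v} → Has u v → Adj G u v
open Subgraph public

InSub : ∀ {n} {G : WGraph n} → Subgraph G → Edge n → Set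
InSub H (u , v) = Has H u v ⊎ Has H v u

Covers : ∀ {n} {G : WGraph n} {s t} → Subgraph G → List (Edge n) → Walk G s t → Set
Covers H F P = All (InSub H) (edges P) × All (λ e → ¬ InSub H e) F

IsRPCovering : ∀ {n} (G : WGraph n) (L f : ℕ) → List (Subgraph G) → Set₁
IsRPCovering {n} G L f 𝒢 =
  ∀ (s t : Fin n) (F : List (Edge n)) →
  All (λ e → Adj G (proj₁ e) (proj₂ e)) F →
  length F ≤ f →
  (∃[ P ] (IsReplacementPath G s t F P × len P ≤ L)) →
  ∃[ P ] (IsReplacementPath G s t F P × len P ≤ L ×
          Any (λ H → Covers H F P) 𝒢)

module Submission where

-- G* has vertices 0, …, n', short edges {x, x+1} of weight 2 and skip edges
-- {x, x+2} of weight 5 + (n' - x). A bit string bs with a digits and r ones is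
-- spread to X = spread bs (each 1 becomes 10); the failure set F_X consists of
-- the short edges at the ones of X, and the path that follows bs (short edge
-- for 0, skip over the failed edge for 1) is a replacement path with a edges.
-- Its optimality is certified by a potential: prefix sums of feasible edge
-- costs lower-bound every walk of G* \ F_X. Raising the cost at a free
-- position j of X keeps it feasible, so every replacement path uses short
-- edge j. Two distinct strings have spreads where one has a free position at
-- a failure of the other, so no subgraph covers both, and a covering needs
-- C(a,r) subgraphs whenever a ≤ L, r ≤ f, a + r ≤ n'. With n^k ≤ C(n,k)·k^k,
-- and an n/3 bound from single failures when L + f > n', L^f ≤ 3·|𝒢|·f^f.

open import Defs
open import Data.Nat using (ℕ; suc; _*_; _^_; _≤_)
open import Data.Product using (_×_; Σ; ∃-syntax)
open import Data.List using (List; length)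

open import Data.Nat
open import Data.Nat.Properties
open import Data.Nat.Combinatorics using (_C_; nC1≡n; nCk+nC[k+1]≡[n+1]C[k+1])
open import Data.Nat.Tactic.RingSolver using (solve-∀)
open import Algebra.Properties.CommutativeSemigroup *-commutativeSemigroup
  using () renaming (interchange to *-interchange; x∙yz≈y∙xz to *-leftComm; xy∙z≈xz∙y to *-rightComm)
open import Relation.Binary.PropositionalEquality
open import Function using (_∘_)
open import Relation.Nullary using (¬_; yes; no)
open import Data.Bool as Bool using (Bool; true; false; if_then_else_)
open import Data.Empty using (⊥; ⊥-elim)
open import Data.Sum as Sum using (_⊎_; inj₁; inj₂)
open import Data.Product using (_,_; proj₁; proj₂)
open import Data.List using ([]; _∷_; replicate; lookup)
open import Data.List.Properties using (length-replicate; ∷-injectiveʳ; ≡-dec)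
open import Data.List.Relation.Unary.All as All using (All; []; _∷_)
open import Data.List.Relation.Unary.Any as Any using (Any; here; there)
open import Data.List.Relation.Unary.Any.Properties using (lookup-index)
open import Data.Fin using (Fin; zero; suc; toℕ; cast; splitAt; join)
open import Data.Fin.Properties using (toℕ-injective; toℕ-cast; join-splitAt; toℕ<n; injective⇒≤)

pascal : ∀ a r → suc a C suc r ≡ a C suc r + a C r
pascal a r = trans (sym (nCk+nC[k+1]≡[n+1]C[k+1] a r)) (+-comm (a C r) (a C suc r))

absorption : ∀ n k → suc k * (suc n C suc k) ≡ suc n * (n C k)
absorption zero    zero    = refl
absorption zero    (suc k) = *-zeroʳ (suc (suc k))
absorption (suc n) zero    =
  trans (+-identityʳ _) (trans (nC1≡n (suc (suc n))) (sym (*-identityʳ _)))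
absorption (suc n) (suc k) = begin
  suc (suc k) * (suc (suc n) C suc (suc k))  ≡⟨ cong (suc (suc k) *_) (pascal (suc n) (suc k)) ⟩
  suc (suc k) * (X + Y)                      ≡⟨ *-distribˡ-+ (suc (suc k)) X Y ⟩
  suc (suc k) * X + (Y + suc k * Y)          ≡⟨ cong₂ (λ u v → u + (Y + v)) (absorption n (suc k)) (absorption n k) ⟩
  suc n * (n C suc k) + (Y + suc n * (n C k)) ≡⟨ regroup (suc n) (n C suc k) (n C k) Y ⟩
  suc n * (n C suc k + n C k) + Y            ≡⟨ cong (λ z → suc n * z + Y) (sym (pascal n k)) ⟩
  suc n * Y + Y                              ≡⟨ +-comm (suc n * Y) Y ⟩
  suc (suc n) * Y                            ∎
  where
    open ≡-Reasoning
    X Y : ℕ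
    X = suc n C suc (suc k)
    Y = suc n C suc k
    regroup : ∀ a b c y → a * b + (y + a * c) ≡ a * (b + c) + y
    regroup = solve-∀

^-distribʳ-* : ∀ a b k → (a * b) ^ k ≡ a ^ k * b ^ k
^-distribʳ-* a b zero    = refl
^-distribʳ-* a b (suc k) =
  trans (cong (a * b *_) (^-distribʳ-* a b k)) (*-interchange a b (a ^ k) (b ^ k))

-- m^m is positive (0^0 = 1); needed to cancel k^k below.
selfPower-positive : ∀ m → 0 < m ^ m
selfPower-positive zero    = s≤s z≤n
selfPower-positive (suc m) = m^n>0 (suc m) (suc m)

-- The standard lower bound (n/k)^k ≤ C(n,k), in the division-free form
-- n^k ≤ C(n,k)·k^k; proved by induction via the absorption identity.
binomial-lowerBound : ∀ n k → k ≤ n → n ^ k ≤ (n C k) * k ^ k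
binomial-lowerBound n       zero    _         = s≤s z≤n
binomial-lowerBound (suc n) (suc k) (s≤s k≤n) = begin
  suc n * suc n ^ k                    ≤⟨ *-monoʳ-≤ (suc n) stepBound ⟩
  suc n * ((n C k) * suc k ^ k)        ≡⟨ sym (*-assoc (suc n) (n C k) (suc k ^ k)) ⟩
  suc n * (n C k) * suc k ^ k          ≡⟨ cong (_* suc k ^ k) (sym (absorption n k)) ⟩
  suc k * (suc n C suc k) * suc k ^ k  ≡⟨ cong (_* suc k ^ k) (*-comm (suc k) (suc n C suc k)) ⟩
  (suc n C suc k) * suc k * suc k ^ k  ≡⟨ *-assoc (suc n C suc k) (suc k) (suc k ^ k) ⟩
  (suc n C suc k) * suc k ^ suc k      ∎
  where
    open ≤-Reasoning
    instance
      kᵏ≢0 : NonZero (k ^ k)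
      kᵏ≢0 = >-nonZero (selfPower-positive k)
    -- (n+1)^k ≤ C(n,k)(k+1)^k, after multiplying both sides by k^k
    -- and using (n+1)k ≤ n(k+1).
    stepBound : suc n ^ k ≤ (n C k) * suc k ^ k
    stepBound = *-cancelʳ-≤ (suc n ^ k) ((n C k) * suc k ^ k) (k ^ k) (begin
      suc n ^ k * k ^ k              ≡⟨ sym (^-distribʳ-* (suc n) k k) ⟩
      (suc n * k) ^ k                ≤⟨ ^-monoˡ-≤ k (+-monoˡ-≤ (n * k) k≤n) ⟩
      (n + n * k) ^ k                ≡⟨ cong (_^ k) (sym (*-suc n k)) ⟩
      (n * suc k) ^ k                ≡⟨ ^-distribʳ-* n (suc k) k ⟩
      n ^ k * suc k ^ k              ≤⟨ *-monoˡ-≤ (suc k ^ k) (binomial-lowerBound n k k≤n) ⟩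
      (n C k) * k ^ k * suc k ^ k    ≡⟨ *-rightComm (n C k) (k ^ k) (suc k ^ k) ⟩
      (n C k) * suc k ^ k * k ^ k    ∎)

ones : List Bool → ℕ
ones []           = 0
ones (true  ∷ bs) = suc (ones bs)
ones (false ∷ bs) = ones bs

bitAt : List Bool → ℕ → Bool
bitAt []       _       = false
bitAt (b ∷ bs) zero    = b
bitAt (b ∷ bs) (suc p) = bitAt bs p

-- An enumeration of the C(a,r) bit strings of length a with r ones,
-- following Pascal's rule: a string starts with 0 or with 1.
enumerate : ∀ a r → Fin (a C r) → List Bool
enumerate-cons : ∀ a r → Fin (a C suc r) ⊎ Fin (a C r) → List Bool
enumerate a       zero    _ = replicate a false
enumerate (suc a) (suc r) i = enumerate-cons a r (splitAt (a C suc r) (cast (pascal a r) i))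
enumerate-cons a r (inj₁ i) = false ∷ enumerate a (suc r) i
enumerate-cons a r (inj₂ i) = true  ∷ enumerate a r i

enumerate-length : ∀ a r i → length (enumerate a r i) ≡ a
enumerate-cons-length : ∀ a r i → length (enumerate-cons a r i) ≡ suc a
enumerate-length a       zero    _ = length-replicate a
enumerate-length (suc a) (suc r) i = enumerate-cons-length a r (splitAt (a C suc r) (cast (pascal a r) i))
enumerate-cons-length a r (inj₁ i) = cong suc (enumerate-length a (suc r) i)
enumerate-cons-length a r (inj₂ i) = cong suc (enumerate-length a r i)

enumerate-ones : ∀ a r i → ones (enumerate a r i) ≡ r
enumerate-cons-ones : ∀ a r i → ones (enumerate-cons a r i) ≡ suc r
enumerate-ones a       zero    _ = onesOfZeros a
  where
    onesOfZeros : ∀ a → ones (replicate a false) ≡ 0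
    onesOfZeros zero    = refl
    onesOfZeros (suc a) = onesOfZeros a
enumerate-ones (suc a) (suc r) i = enumerate-cons-ones a r (splitAt (a C suc r) (cast (pascal a r) i))
enumerate-cons-ones a r (inj₁ i) = enumerate-ones a (suc r) i
enumerate-cons-ones a r (inj₂ i) = cong suc (enumerate-ones a r i)

enumerate-injective : ∀ a r {i j} → enumerate a r i ≡ enumerate a r j → i ≡ j
enumerate-cons-injective : ∀ a r {i j} → enumerate-cons a r i ≡ enumerate-cons a r j → i ≡ j
enumerate-injective zero    zero    {zero} {zero} _ = refl
enumerate-injective (suc a) zero    {zero} {zero} _ = refl
enumerate-injective (suc a) (suc r) {i} {j} eq =
  cast-injective (splitAt-injective (enumerate-cons-injective a r eq))
  where
    splitAt-injective : ∀ {x y} → splitAt (a C suc r) x ≡ splitAt (a C suc r) y → x ≡ y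
    splitAt-injective {x} {y} e = begin
      x                                     ≡⟨ sym (join-splitAt (a C suc r) (a C r) x) ⟩
      join _ (a C r) (splitAt (a C suc r) x) ≡⟨ cong (join _ (a C r)) e ⟩
      join _ (a C r) (splitAt (a C suc r) y) ≡⟨ join-splitAt (a C suc r) (a C r) y ⟩
      y                                     ∎
      where open ≡-Reasoning
    cast-injective : cast (pascal a r) i ≡ cast (pascal a r) j → i ≡ j
    cast-injective e = toℕ-injective (begin
      toℕ i                    ≡⟨ sym (toℕ-cast (pascal a r) i) ⟩
      toℕ (cast (pascal a r) i) ≡⟨ cong toℕ e ⟩
      toℕ (cast (pascal a r) j) ≡⟨ toℕ-cast (pascal a r) j ⟩
      toℕ j                    ∎)
      where open ≡-Reasoning
enumerate-cons-injective a r {inj₁ i} {inj₁ j} eq = cong inj₁ (enumerate-injective a (suc r) (∷-injectiveʳ eq))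
enumerate-cons-injective a r {inj₂ i} {inj₂ j} eq = cong inj₂ (enumerate-injective a r (∷-injectiveʳ eq))
enumerate-cons-injective a r {inj₁ i} {inj₂ j} ()
enumerate-cons-injective a r {inj₂ i} {inj₁ j} ()

-- Spreading replaces every 1 by the block 10; the ones of a spread string
-- mark the failed edges of a failure pattern, and are never adjacent.
spread : List Bool → List Bool
spread []           = []
spread (false ∷ bs) = false ∷ spread bs
spread (true  ∷ bs) = true ∷ false ∷ spread bs

spread-length : ∀ bs → length (spread bs) ≡ length bs + ones bs
spread-length []           = refl
spread-length (false ∷ bs) = cong suc (spread-length bs)
spread-length (true  ∷ bs) = cong suc (trans (cong suc (spread-length bs)) (sym (+-suc _ _)))

spread-ones : ∀ bs → ones (spread bs) ≡ ones bs
spread-ones []           = refl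
spread-ones (false ∷ bs) = spread-ones bs
spread-ones (true  ∷ bs) = cong suc (spread-ones bs)

Isolated : List Bool → Set
Isolated X = ∀ p → bitAt X p ≡ true → bitAt X (suc p) ≡ false

spread-isolated : ∀ bs → Isolated (spread bs)
spread-isolated (false ∷ bs) (suc p)       e = spread-isolated bs p e
spread-isolated (true  ∷ bs) zero          e = refl
spread-isolated (true  ∷ bs) (suc (suc p)) e = spread-isolated bs p e

-- Position j of X is free if X has a 0 there that is not the 0 of a block 10.
Free : List Bool → ℕ → Set
Free X j = j < length X × bitAt X j ≡ false × (∀ p → suc p ≡ j → bitAt X p ≡ false)

Separates : List Bool → List Bool → Set
Separates X Y = Σ ℕ λ j → Free X j × bitAt Y j ≡ true

separates-0 : ∀ {X Y} → Separates X Y → Separates (false ∷ X) (false ∷ Y)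
separates-0 {X} (j , (j<X , Xj , noBlock) , Yj) = suc j , (s≤s j<X , Xj , noBlock′) , Yj
  where
    noBlock′ : ∀ p → suc p ≡ suc j → bitAt (false ∷ X) p ≡ false
    noBlock′ zero    _ = refl
    noBlock′ (suc p) e = noBlock p (suc-injective e)

separates-10 : ∀ {X Y} → Separates X Y → Separates (true ∷ false ∷ X) (true ∷ false ∷ Y)
separates-10 {X} (j , (j<X , Xj , noBlock) , Yj) = suc (suc j) , (s≤s (s≤s j<X) , Xj , noBlock′) , Yj
  where
    noBlock′ : ∀ p → suc p ≡ suc (suc j) → bitAt (true ∷ false ∷ X) p ≡ false
    noBlock′ zero          ()
    noBlock′ (suc zero)    _ = refl
    noBlock′ (suc (suc p)) e = noBlock p (suc-injective (suc-injective e))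

-- Distinct strings of equal length have spreads separated one way or the
-- other: at their first difference, the spread with the 0 has a free
-- position where the other has a 1.
spread-separates : ∀ bs cs → length bs ≡ length cs → bs ≢ cs →
                   Separates (spread bs) (spread cs) ⊎ Separates (spread cs) (spread bs)
spread-separates []           []           _ bs≢cs = ⊥-elim (bs≢cs refl)
spread-separates (false ∷ bs) (true  ∷ cs) _ _     = inj₁ (0 , (s≤s z≤n , refl , λ _ ()) , refl)
spread-separates (true  ∷ bs) (false ∷ cs) _ _     = inj₂ (0 , (s≤s z≤n , refl , λ _ ()) , refl)
spread-separates (false ∷ bs) (false ∷ cs) e bs≢cs =
  Sum.map separates-0 separates-0
    (spread-separates bs cs (suc-injective e) (bs≢cs ∘ cong (false ∷_)))
spread-separates (true  ∷ bs) (true  ∷ cs) e bs≢cs =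
  Sum.map separates-10 separates-10
    (spread-separates bs cs (suc-injective e) (bs≢cs ∘ cong (true ∷_)))

-- Potential lower bound (LP duality for shortest paths, weak direction):
-- if φ grows by at most w(u,v) along every edge u→v of G outside F, then
-- every walk of G \ F from s to t has weight at least φ t - φ s.
potential-lowerBound : ∀ {n} (G : WGraph n) (F : List (Edge n)) (φ : Fin n → ℕ) →
  (∀ u v → Adj G u v → ¬ (u , v) ∈ᴱ F → φ v ≤ φ u + w G u v) →
  ∀ {s t} (Q : Walk G s t) → Avoids F Q → φ t ≤ φ s + weight Q
potential-lowerBound G F φ feasible []               _             = m≤m+n _ _
potential-lowerBound G F φ feasible {t = t} (step u v uv Q) (uv∉F ∷ Q-avoids) = begin
  φ t                           ≤⟨ potential-lowerBound G F φ feasible Q Q-avoids ⟩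
  φ v + weight Q                ≤⟨ +-monoˡ-≤ (weight Q) (feasible u v uv uv∉F) ⟩
  φ u + w G u v + weight Q      ≡⟨ +-assoc (φ u) (w G u v) (weight Q) ⟩
  φ u + (w G u v + weight Q)    ∎
  where open ≤-Reasoning

inSub-respects : ∀ {n} {G : WGraph n} (H : Subgraph G) {e e′ : Edge n} →
                 SameEdge e e′ → InSub H e → InSub H e′
inSub-respects H (inj₁ (refl , refl)) e∈H        = e∈H
inSub-respects H (inj₂ (refl , refl)) (inj₁ uv) = inj₂ uv
inSub-respects H (inj₂ (refl , refl)) (inj₂ vu) = inj₁ vu

disjoint-misses : ∀ {n} {G : WGraph n} (H : Subgraph G) {F : List (Edge n)} {e} →
                  All (λ d → ¬ InSub H d) F → e ∈ᴱ F → ¬ InSub H e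
disjoint-misses H H∩F=∅ e∈F e∈H with All.lookupAny H∩F=∅ e∈F
... | d∉H , e≈d = d∉H (inSub-respects H e≈d e∈H)

avoids-outside : ∀ {n} {G : WGraph n} (H : Subgraph G) {F : List (Edge n)} {e s t} (P : Walk G s t) →
                 All (InSub H) (edges P) → ¬ InSub H e → Avoids F P → Avoids (e ∷ F) P
avoids-outside H {F} {e} P P⊆H e∉H P-avoids = All.zipWith avoid (P⊆H , P-avoids)
  where
    avoid : ∀ {d} → InSub H d × ¬ d ∈ᴱ F → ¬ d ∈ᴱ (e ∷ F)
    avoid (d∈H , _)   (here d≈e)  = e∉H (inSub-respects H d≈e d∈H)
    avoid (_ , d∉F)   (there d∈F) = d∉F d∈F

-- prefixSum c x = c 0 + … + c (x-1); prefix sums of edge costs are the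
-- potentials used on the path-like graph below.
prefixSum : (ℕ → ℕ) → ℕ → ℕ
prefixSum c zero    = 0
prefixSum c (suc x) = prefixSum c x + c x

prefixSum-mono : ∀ {c c′} → (∀ p → c p ≤ c′ p) → ∀ x → prefixSum c x ≤ prefixSum c′ x
prefixSum-mono c≤c′ zero    = z≤n
prefixSum-mono c≤c′ (suc x) = +-mono-≤ (prefixSum-mono c≤c′ x) (c≤c′ x)

prefixSum-strict : ∀ {c c′ j} → (∀ p → c p ≤ c′ p) → c j < c′ j →
                   ∀ x → j < x → prefixSum c x < prefixSum c′ x
prefixSum-strict {j = j} c≤c′ cj<c′j (suc x) (s≤s j≤x) with m≤n⇒m<n∨m≡n j≤x
... | inj₁ j<x  = +-mono-<-≤ (prefixSum-strict c≤c′ cj<c′j x j<x) (c≤c′ x)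
... | inj₂ refl = +-mono-≤-< (prefixSum-mono c≤c′ j) cj<c′j

prefixSum-≤ : ∀ c y → prefixSum c y ≤ prefixSum c (suc y)
prefixSum-≤ c y = m≤m+n (prefixSum c y) (c y)

≢-translate : ∀ d i → 0 < d → d + i ≢ i
≢-translate d i 0<d e = <-irrefl (sym e) (m<n+m i 0<d)

-- Conversion of a number to a vertex of Fin (1 + n'), clamped at n';
-- it is exact on 0, …, n'.
clamp : (n' : ℕ) → ℕ → Fin (suc n')
clamp zero     _       = zero
clamp (suc n') zero    = zero
clamp (suc n') (suc p) = suc (clamp n' p)

toℕ-clamp : ∀ n' p → p ≤ n' → toℕ (clamp n' p) ≡ p
toℕ-clamp zero     zero    _         = refl
toℕ-clamp (suc n') zero    _         = refl
toℕ-clamp (suc n') (suc p) (s≤s p≤n) = cong suc (toℕ-clamp n' p p≤n)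

clamp-toℕ : ∀ n' (u : Fin (suc n')) → clamp n' (toℕ u) ≡ u
clamp-toℕ zero     zero    = refl
clamp-toℕ (suc n') zero    = refl
clamp-toℕ (suc n') (suc u) = cong suc (clamp-toℕ n' u)

data Link : ℕ → ℕ → Set where
  short  : ∀ x → Link x (suc x)
  short⁻ : ∀ x → Link (suc x) x
  skip   : ∀ x → Link x (suc (suc x))
  skip⁻  : ∀ x → Link (suc (suc x)) x

Link-sym : ∀ {x y} → Link x y → Link y x
Link-sym (short x)  = short⁻ x
Link-sym (short⁻ x) = short x
Link-sym (skip x)   = skip⁻ x
Link-sym (skip⁻ x)  = skip x

Link-irrefl : ∀ {x} → ¬ Link x x
Link-irrefl ()

module SkipPath (n' : ℕ) where

  vertex : ℕ → Fin (suc n')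
  vertex = clamp n'

  vertex-injective : ∀ {a b} → a ≤ n' → b ≤ n' → vertex a ≡ vertex b → a ≡ b
  vertex-injective {a} {b} a≤n b≤n e =
    trans (sym (toℕ-clamp n' a a≤n)) (trans (cong toℕ e) (toℕ-clamp n' b b≤n))

  toℕ≤n' : (u : Fin (suc n')) → toℕ u ≤ n'
  toℕ≤n' u = ≤-pred (toℕ<n u)

  skipWeight : ℕ → ℕ
  skipWeight x = 5 + (n' ∸ x)

  -- Weight of a pair of numbers; only its values on links matter.
  pairWeight : ℕ → ℕ → ℕ
  pairWeight x y = if ∣ x - y ∣ ≡ᵇ 1 then 2 else skipWeight (x ⊓ y)

  pairWeight-sym : ∀ x y → pairWeight x y ≡ pairWeight y x
  pairWeight-sym x y rewrite ∣-∣-comm x y | ⊓-comm x y = refl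

  pairWeight-short : ∀ x → pairWeight x (suc x) ≡ 2
  pairWeight-short x rewrite trans (cong (∣ x -_∣) (+-comm 1 x)) (∣m-m+n∣≡n x 1) = refl

  pairWeight-skip : ∀ x → pairWeight x (suc (suc x)) ≡ skipWeight x
  pairWeight-skip x
    rewrite trans (cong (∣ x -_∣) (+-comm 2 x)) (∣m-m+n∣≡n x 2)
          | m≤n⇒m⊓n≡m (m≤n+m x 2) = refl

  graph : WGraph (suc n')
  graph = record
    { Adj        = λ u v → Link (toℕ u) (toℕ v)
    ; w          = λ u v → pairWeight (toℕ u) (toℕ v)
    ; Adj-sym    = Link-sym
    ; Adj-irrefl = Link-irrefl
    ; w-sym      = λ u v → pairWeight-sym (toℕ u) (toℕ v)
    ; w-pos      = λ {u} {v} _ → pairWeight-pos (toℕ u) (toℕ v)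
    }
    where
      pairWeight-pos : ∀ x y → 1 ≤ pairWeight x y
      pairWeight-pos x y with ∣ x - y ∣ ≡ᵇ 1
      ... | true  = s≤s z≤n
      ... | false = s≤s z≤n

  shortEdge skipEdge : ℕ → Edge (suc n')
  shortEdge x = vertex x , vertex (suc x)
  skipEdge  x = vertex x , vertex (suc (suc x))

  shortEdge-adjacent : ∀ x → suc x ≤ n' → Adj graph (vertex x) (vertex (suc x))
  shortEdge-adjacent x x+1≤n rewrite toℕ-clamp n' x (≤-trans (n≤1+n x) x+1≤n)
                                   | toℕ-clamp n' (suc x) x+1≤n = short x

  skipEdge-adjacent : ∀ x → suc (suc x) ≤ n' → Adj graph (vertex x) (vertex (suc (suc x)))
  skipEdge-adjacent x x+2≤n rewrite toℕ-clamp n' x (≤-trans (m≤n+m x 2) x+2≤n)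
                                  | toℕ-clamp n' (suc (suc x)) x+2≤n = skip x

  shortEdge-weight : ∀ x → suc x ≤ n' → w graph (vertex x) (vertex (suc x)) ≡ 2
  shortEdge-weight x x+1≤n rewrite toℕ-clamp n' x (≤-trans (n≤1+n x) x+1≤n)
                                 | toℕ-clamp n' (suc x) x+1≤n = pairWeight-short x

  skipEdge-weight : ∀ x → suc (suc x) ≤ n' → w graph (vertex x) (vertex (suc (suc x))) ≡ skipWeight x
  skipEdge-weight x x+2≤n rewrite toℕ-clamp n' x (≤-trans (m≤n+m x 2) x+2≤n)
                                | toℕ-clamp n' (suc (suc x)) x+2≤n = pairWeight-skip x

  record Feasible (c : ℕ → ℕ) (Blocked : ℕ → Set) : Set where
    field
      unblocked-short : ∀ x → suc x ≤ n' → ¬ Blocked x → c x ≤ 2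
      skip-pair       : ∀ x → suc (suc x) ≤ n' → c x + c (suc x) ≤ skipWeight x

  -- Feasible costs give a potential on every unblocked link; backward
  -- links are free since prefix sums are monotone.
  feasible-link : ∀ {c B} → Feasible c B → ∀ {x y} → Link x y → y ≤ n' →
                  (y ≡ suc x → ¬ B x) → prefixSum c y ≤ prefixSum c x + pairWeight x y
  feasible-link {c} feas (short x) y≤n unblocked rewrite pairWeight-short x =
    +-monoʳ-≤ (prefixSum c x) (Feasible.unblocked-short feas x y≤n (unblocked refl))
  feasible-link {c} feas (short⁻ y) _ _ =
    ≤-trans (prefixSum-≤ c y) (m≤m+n _ _)
  feasible-link {c} feas (skip x) y≤n _
    rewrite pairWeight-skip x | +-assoc (prefixSum c x) (c x) (c (suc x)) =
    +-monoʳ-≤ (prefixSum c x) (Feasible.skip-pair feas x y≤n)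
  feasible-link {c} feas (skip⁻ y) _ _ =
    ≤-trans (prefixSum-≤ c y) (≤-trans (prefixSum-≤ c (suc y)) (m≤m+n _ _))

  feasible-lowerBound : ∀ {c B} → Feasible c B → (F : List (Edge (suc n'))) →
    (∀ x → suc x ≤ n' → B x → shortEdge x ∈ᴱ F) → ∀ {m} → m ≤ n' →
    (Q : Walk graph (vertex 0) (vertex m)) → Avoids F Q → prefixSum c m ≤ weight Q
  feasible-lowerBound {c} {B} feas F blocked⊆F {m} m≤n Q Q-avoids =
    subst₂ (λ y x → prefixSum c y ≤ prefixSum c x + weight Q)
      (toℕ-clamp n' m m≤n) (toℕ-clamp n' 0 z≤n)
      (potential-lowerBound graph F (prefixSum c ∘ toℕ) potential Q Q-avoids)
    where
      potential : ∀ u v → Adj graph u v → ¬ (u , v) ∈ᴱ F →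
                  prefixSum c (toℕ v) ≤ prefixSum c (toℕ u) + w graph u v
      potential u v uv uv∉F = feasible-link feas uv (toℕ≤n' v) unblocked
        where
          unblocked : toℕ v ≡ suc (toℕ u) → ¬ B (toℕ u)
          unblocked v≡u+1 Bu = uv∉F (subst₂ (λ p q → (p , q) ∈ᴱ F)
            (clamp-toℕ n' u) (trans (cong vertex (sym v≡u+1)) (clamp-toℕ n' v))
            (blocked⊆F (toℕ u) (subst (_≤ n') v≡u+1 (toℕ≤n' v)) Bu))

  failedFrom : ℕ → List Bool → List (Edge (suc n'))
  failedFrom k []          = []
  failedFrom k (true  ∷ X) = shortEdge k ∷ failedFrom (suc k) X
  failedFrom k (false ∷ X) = failedFrom (suc k) X

  failures : List Bool → List (Edge (suc n'))
  failures = failedFrom 0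

  failedFrom-count : ∀ X k → length (failedFrom k X) ≡ ones X
  failedFrom-count []          k = refl
  failedFrom-count (true  ∷ X) k = cong suc (failedFrom-count X (suc k))
  failedFrom-count (false ∷ X) k = failedFrom-count X (suc k)

  failedFrom-adjacent : ∀ X k → k + length X ≤ n' →
                        All (λ e → Adj graph (proj₁ e) (proj₂ e)) (failedFrom k X)
  failedFrom-adjacent []          k _   = []
  failedFrom-adjacent (true  ∷ X) k end =
    shortEdge-adjacent k (≤-trans (m<m+n k (s≤s z≤n)) end)
      ∷ failedFrom-adjacent X (suc k) (subst (_≤ n') (+-suc k _) end)
  failedFrom-adjacent (false ∷ X) k end =
    failedFrom-adjacent X (suc k) (subst (_≤ n') (+-suc k _) end)

  failedFrom-complete : ∀ X k i → bitAt X i ≡ true → shortEdge (k + i) ∈ᴱ failedFrom k X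
  failedFrom-complete (true  ∷ X) k zero    _  = here (inj₁ (cong vertex (+-identityʳ k) ,
                                                          cong (vertex ∘ suc) (+-identityʳ k)))
  failedFrom-complete (true  ∷ X) k (suc i) Xi =
    there (subst (λ z → shortEdge z ∈ᴱ failedFrom (suc k) X) (sym (+-suc k i)) (failedFrom-complete X (suc k) i Xi))
  failedFrom-complete (false ∷ X) k (suc i) Xi =
    subst (λ z → shortEdge z ∈ᴱ failedFrom (suc k) X) (sym (+-suc k i)) (failedFrom-complete X (suc k) i Xi)

  FailedAt : List Bool → ℕ → Edge (suc n') → Set
  FailedAt X k e = Σ ℕ λ i → bitAt X i ≡ true × i < length X × SameEdge e (shortEdge (k + i))

  failedAt-cons : ∀ b X k e → FailedAt X (suc k) e → FailedAt (b ∷ X) k e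
  failedAt-cons b X k e (i , Xi , i<X , e≈) =
    suc i , Xi , s≤s i<X , subst (λ z → SameEdge e (shortEdge z)) (sym (+-suc k i)) e≈

  failedFrom-sound : ∀ X k e → e ∈ᴱ failedFrom k X → FailedAt X k e
  failedFrom-sound (true  ∷ X) k e (here e≈k) =
    0 , refl , s≤s z≤n , subst (λ z → SameEdge e (shortEdge z)) (sym (+-identityʳ k)) e≈k
  failedFrom-sound (true  ∷ X) k e (there e∈) = failedAt-cons true X k e (failedFrom-sound X (suc k) e e∈)
  failedFrom-sound (false ∷ X) k e e∈         = failedAt-cons false X k e (failedFrom-sound X (suc k) e e∈)

  shortEdge-same : ∀ {x i} → suc x ≤ n' → suc i ≤ n' → SameEdge (shortEdge x) (shortEdge i) → x ≡ i
  shortEdge-same x+1≤n i+1≤n (inj₁ (x≈i , _)) =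
    vertex-injective (≤-trans (n≤1+n _) x+1≤n) (≤-trans (n≤1+n _) i+1≤n) x≈i
  shortEdge-same {x} {i} x+1≤n i+1≤n (inj₂ (x≈i+1 , x+1≈i)) =
    ⊥-elim (≢-translate 2 i (s≤s z≤n) (trans (cong suc (sym x≡i+1)) x+1≡i))
    where
      x≡i+1 : x ≡ suc i
      x≡i+1 = vertex-injective (≤-trans (n≤1+n _) x+1≤n) i+1≤n x≈i+1
      x+1≡i : suc x ≡ i
      x+1≡i = vertex-injective x+1≤n (≤-trans (n≤1+n _) i+1≤n) x+1≈i

  skipEdge-notShort : ∀ {x i} → suc (suc x) ≤ n' → suc i ≤ n' → ¬ SameEdge (skipEdge x) (shortEdge i)
  skipEdge-notShort {x} {i} x+2≤n i+1≤n (inj₁ (x≈i , x+2≈i+1)) =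
    ≢-translate 1 (suc i) (s≤s z≤n) (trans (cong (2 +_) (sym x≡i)) x+2≡i+1)
    where
      x≡i : x ≡ i
      x≡i = vertex-injective (≤-trans (m≤n+m x 2) x+2≤n) (≤-trans (n≤1+n _) i+1≤n) x≈i
      x+2≡i+1 : suc (suc x) ≡ suc i
      x+2≡i+1 = vertex-injective x+2≤n i+1≤n x+2≈i+1
  skipEdge-notShort {x} {i} x+2≤n i+1≤n (inj₂ (x≈i+1 , x+2≈i)) =
    ≢-translate 3 i (s≤s z≤n) (trans (cong (2 +_) (sym x≡i+1)) x+2≡i)
    where
      x≡i+1 : x ≡ suc i
      x≡i+1 = vertex-injective (≤-trans (m≤n+m x 2) x+2≤n) i+1≤n x≈i+1
      x+2≡i : suc (suc x) ≡ i
      x+2≡i = vertex-injective x+2≤n (≤-trans (n≤1+n _) i+1≤n) x+2≈i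

  shortEdge-failed : ∀ X x → length X ≤ n' → suc x ≤ n' →
                     shortEdge x ∈ᴱ failures X → bitAt X x ≡ true
  shortEdge-failed X x X≤n x+1≤n failed with failedFrom-sound X 0 (shortEdge x) failed
  ... | i , Xi , i<X , same =
    subst (λ z → bitAt X z ≡ true) (sym (shortEdge-same x+1≤n (≤-trans i<X X≤n) same)) Xi

  skipEdge-survives : ∀ X x → length X ≤ n' → suc (suc x) ≤ n' → ¬ skipEdge x ∈ᴱ failures X
  skipEdge-survives X x X≤n x+2≤n failed with failedFrom-sound X 0 (skipEdge x) failed
  ... | i , _ , i<X , same = skipEdge-notShort x+2≤n (≤-trans i<X X≤n) same

  -- The cost of short edge p under pattern X: a failed edge costs 3 + (n' - p),
  -- making the skip edge at p exactly as heavy as the two short edges it bypasses.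
  cost : List Bool → ℕ → ℕ
  cost X p = if bitAt X p then 3 + (n' ∸ p) else 2

  cost-unfailed : ∀ X p → bitAt X p ≡ false → cost X p ≡ 2
  cost-unfailed X p Xp rewrite Xp = refl

  cost-failed : ∀ X p → bitAt X p ≡ true → cost X p ≡ 3 + (n' ∸ p)
  cost-failed X p Xp rewrite Xp = refl

  cost-feasible : ∀ X → Isolated X → Feasible (cost X) (λ x → bitAt X x ≡ true)
  cost-feasible X isolated = record { unblocked-short = unblocked ; skip-pair = pair }
    where
      unblocked : ∀ x → suc x ≤ n' → ¬ bitAt X x ≡ true → cost X x ≤ 2
      unblocked x _ notFailed with bitAt X x
      ... | true  = ⊥-elim (notFailed refl)
      ... | false = ≤-refl
      pair : ∀ x → suc (suc x) ≤ n' → cost X x + cost X (suc x) ≤ skipWeight x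
      pair x _ with bitAt X x in Xx
      ... | true rewrite isolated x Xx = ≤-reflexive (+-comm (3 + (n' ∸ x)) 2)
      ... | false with bitAt X (suc x)
      ...   | true  = s≤s (s≤s (s≤s (s≤s (s≤s (∸-monoʳ-≤ n' (n≤1+n x))))))
      ...   | false = s≤s (s≤s (s≤s (s≤s z≤n)))

  bumped : List Bool → ℕ → ℕ → ℕ
  bumped X j p with p ≟ j
  ... | yes _ = 3
  ... | no  _ = cost X p

  -- At a free position j the raised cost stays feasible when j is blocked too;
  -- freeness rules out a failed edge just before j, and skip weights decrease
  -- by one per position to absorb a failed edge just after j.
  bumped-feasible : ∀ X j → Isolated X → Free X j →
                    Feasible (bumped X j) (λ x → x ≡ j ⊎ bitAt X x ≡ true)
  bumped-feasible X j isolated (_ , Xj , notAfterOne) =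
    record { unblocked-short = unblocked ; skip-pair = pair }
    where
      base : Feasible (cost X) (λ x → bitAt X x ≡ true)
      base = cost-feasible X isolated
      unblocked : ∀ x → suc x ≤ n' → ¬ (x ≡ j ⊎ bitAt X x ≡ true) → bumped X j x ≤ 2
      unblocked x x+1≤n notBlocked with x ≟ j
      ... | yes x≡j = ⊥-elim (notBlocked (inj₁ x≡j))
      ... | no  _   = Feasible.unblocked-short base x x+1≤n (notBlocked ∘ inj₂)
      pair : ∀ x → suc (suc x) ≤ n' → bumped X j x + bumped X j (suc x) ≤ skipWeight x
      pair x x+2≤n with x ≟ j | suc x ≟ j
      ... | yes x≡j | yes x+1≡j = ⊥-elim (1+n≢n (trans x+1≡j (sym x≡j)))
      ... | yes _   | no  _ with bitAt X (suc x)
      ...   | true  = s≤s (s≤s (s≤s (s≤s (s≤s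
                        (≤-reflexive (sym (+-∸-assoc 1 (≤-trans (n≤1+n _) x+2≤n))))))))
      ...   | false = s≤s (s≤s (s≤s (s≤s (s≤s z≤n))))
      pair x x+2≤n | no _ | yes x+1≡j
        rewrite cost-unfailed X x (notAfterOne x x+1≡j) = s≤s (s≤s (s≤s (s≤s (s≤s z≤n))))
      pair x x+2≤n | no _ | no _ = Feasible.skip-pair base x x+2≤n

  bumped-≥ : ∀ X j → bitAt X j ≡ false → ∀ p → cost X p ≤ bumped X j p
  bumped-≥ X j Xj p with p ≟ j
  ... | yes refl rewrite cost-unfailed X p Xj = n≤1+n 2
  ... | no  _    = ≤-refl

  bumped-> : ∀ X j → bitAt X j ≡ false → cost X j < bumped X j j
  bumped-> X j Xj with j ≟ j
  ... | yes _   rewrite cost-unfailed X j Xj = n<1+n 2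
  ... | no  j≢j = ⊥-elim (j≢j refl)

  Aligned : List Bool → ℕ → List Bool → Set
  Aligned X k Y = ∀ i → bitAt X (i + k) ≡ bitAt Y i

  aligned-self : ∀ X → Aligned X 0 X
  aligned-self X i = cong (bitAt X) (+-identityʳ i)

  aligned-tail : ∀ X k {b Y} → Aligned X k (b ∷ Y) → Aligned X (suc k) Y
  aligned-tail X k aligned i =
    trans (cong (bitAt X) (+-suc i k)) (aligned (suc i))

  shortStep≤ : ∀ d k x → suc d + k ≡ x → x ≤ n' → suc k ≤ n'
  shortStep≤ d k x e x≤n = ≤-trans (s≤s (m≤n+m k d)) (subst (_≤ n') (sym e) x≤n)

  skipStep≤ : ∀ d k x → suc (suc d) + k ≡ x → x ≤ n' → suc (suc k) ≤ n'
  skipStep≤ d k x e x≤n = ≤-trans (s≤s (s≤s (m≤n+m k d))) (subst (_≤ n') (sym e) x≤n)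

  followPath : ∀ bs k x → length (spread bs) + k ≡ x → x ≤ n' → Walk graph (vertex k) (vertex x)
  followPath []           k .k refl _   = []
  followPath (false ∷ bs) k x  e    x≤n =
    step (vertex k) (vertex (suc k))
         (shortEdge-adjacent k (shortStep≤ _ k x e x≤n))
         (followPath bs (suc k) x (trans (+-suc _ k) e) x≤n)
  followPath (true  ∷ bs) k x  e    x≤n =
    step (vertex k) (vertex (suc (suc k)))
         (skipEdge-adjacent k (skipStep≤ _ k x e x≤n))
         (followPath bs (suc (suc k)) x (trans (+-suc _ (suc k)) (trans (cong suc (+-suc _ k)) e)) x≤n)

  followPath-len : ∀ bs k x e x≤n → len (followPath bs k x e x≤n) ≡ length bs
  followPath-len []           k .k refl _   = refl
  followPath-len (false ∷ bs) k x  e    x≤n = cong suc (followPath-len bs (suc k) x _ x≤n)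
  followPath-len (true  ∷ bs) k x  e    x≤n = cong suc (followPath-len bs (suc (suc k)) x _ x≤n)

  followPath-weight : ∀ X bs k x e x≤n → Aligned X k (spread bs) →
    prefixSum (cost X) k + weight (followPath bs k x e x≤n) ≡ prefixSum (cost X) x
  followPath-weight X []           k .k refl _   _       = +-identityʳ _
  followPath-weight X (false ∷ bs) k x  e    x≤n aligned = begin
    Φ k + (w graph (vertex k) (vertex (suc k)) + rest) ≡⟨ cong (λ z → Φ k + (z + rest)) (shortEdge-weight k (shortStep≤ _ k x e x≤n)) ⟩
    Φ k + (2 + rest)                                   ≡⟨ sym (+-assoc (Φ k) 2 rest) ⟩
    Φ k + 2 + rest                                     ≡⟨ cong (λ z → Φ k + z + rest) (sym (cost-unfailed X k (aligned 0))) ⟩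
    Φ (suc k) + rest                                   ≡⟨ followPath-weight X bs (suc k) x _ x≤n (aligned-tail X k aligned) ⟩
    Φ x                                                ∎
    where
      open ≡-Reasoning
      Φ : ℕ → ℕ
      Φ = prefixSum (cost X)
      rest : ℕ
      rest = weight (followPath bs (suc k) x (trans (+-suc _ k) e) x≤n)
  followPath-weight X (true  ∷ bs) k x  e    x≤n aligned = begin
    Φ k + (w graph (vertex k) (vertex (suc (suc k))) + rest) ≡⟨ cong (λ z → Φ k + (z + rest)) (skipEdge-weight k (skipStep≤ _ k x e x≤n)) ⟩
    Φ k + (5 + (n' ∸ k) + rest)                              ≡⟨ split (Φ k) (n' ∸ k) rest ⟩
    Φ k + (3 + (n' ∸ k)) + 2 + rest                          ≡⟨ cong₂ (λ y z → Φ k + y + z + rest) (sym (cost-failed X k (aligned 0)))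
                                                                                                       (sym (cost-unfailed X (suc k) (aligned 1))) ⟩
    Φ (suc (suc k)) + rest                                   ≡⟨ followPath-weight X bs (suc (suc k)) x _ x≤n (aligned-tail X (suc k) (aligned-tail X k aligned)) ⟩
    Φ x                                                      ∎
    where
      open ≡-Reasoning
      Φ : ℕ → ℕ
      Φ = prefixSum (cost X)
      rest : ℕ
      rest = weight (followPath bs (suc (suc k)) x (trans (+-suc _ (suc k)) (trans (cong suc (+-suc _ k)) e)) x≤n)
      split : ∀ a d r → a + (5 + d + r) ≡ a + (3 + d) + 2 + r
      split = solve-∀

  followPath-avoids : ∀ X bs k x e x≤n → Aligned X k (spread bs) → length X ≤ n' →
                      Avoids (failures X) (followPath bs k x e x≤n)
  followPath-avoids X []           k .k refl _   _       _   = []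
  followPath-avoids X (false ∷ bs) k x  e    x≤n aligned X≤n =
    (λ failed → false≢true (trans (sym (aligned 0)) (shortEdge-failed X k X≤n (shortStep≤ _ k x e x≤n) failed)))
      ∷ followPath-avoids X bs (suc k) x _ x≤n (aligned-tail X k aligned) X≤n
    where
      false≢true : false ≢ true
      false≢true ()
  followPath-avoids X (true  ∷ bs) k x  e    x≤n aligned X≤n =
    skipEdge-survives X k X≤n (skipStep≤ _ k x e x≤n)
      ∷ followPath-avoids X bs (suc (suc k)) x _ x≤n (aligned-tail X (suc k) (aligned-tail X k aligned)) X≤n

  module Pattern (bs : List Bool) {m : ℕ} (X≡m : length (spread bs) ≡ m) (m≤n : m ≤ n') where

    X : List Bool
    X = spread bs

    X≤n : length X ≤ n'
    X≤n = subst (_≤ n') (sym X≡m) m≤n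

    failures-blocked : ∀ x → suc x ≤ n' → bitAt X x ≡ true → shortEdge x ∈ᴱ failures X
    failures-blocked x _ Xx = failedFrom-complete X 0 x Xx

    canonical : Walk graph (vertex 0) (vertex m)
    canonical = followPath bs 0 m (trans (+-identityʳ _) X≡m) m≤n

    canonical-weight : weight canonical ≡ prefixSum (cost X) m
    canonical-weight = followPath-weight X bs 0 m _ m≤n (aligned-self X)

    distance-lowerBound : ∀ Q → Avoids (failures X) Q → prefixSum (cost X) m ≤ weight Q
    distance-lowerBound = feasible-lowerBound (cost-feasible X (spread-isolated bs))
                            (failures X) failures-blocked m≤n

    canonical-replacement : IsReplacementPath graph (vertex 0) (vertex m) (failures X) canonical
    canonical-replacement =
      followPath-avoids X bs 0 m _ m≤n (aligned-self X) X≤n ,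
      λ Q Q-avoids → subst (_≤ weight Q) (sym canonical-weight) (distance-lowerBound Q Q-avoids)

    -- Every replacement path for F_X uses the short edge at each free position j:
    -- a path avoiding it too would weigh at least the potential of the cost
    -- raised at j, which exceeds the weight of the canonical path.
    replacement-usesFree : ∀ {P j} → IsReplacementPath graph (vertex 0) (vertex m) (failures X) P →
                           Free X j → ¬ Avoids (shortEdge j ∷ failures X) P
    replacement-usesFree {P} {j} (_ , P-shortest) free@(j<X , Xj , _) P-avoids-j =
      <-irrefl refl (begin-strict
        weight P                      ≤⟨ P-shortest canonical (proj₁ canonical-replacement) ⟩
        weight canonical              ≡⟨ canonical-weight ⟩
        prefixSum (cost X) m          <⟨ prefixSum-strict (bumped-≥ X j Xj) (bumped-> X j Xj) m
                                           (subst (j <_) X≡m j<X) ⟩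
        prefixSum (bumped X j) m      ≤⟨ feasible-lowerBound (bumped-feasible X j (spread-isolated bs) free)
                                           (shortEdge j ∷ failures X) blocked m≤n P P-avoids-j ⟩
        weight P                      ∎)
      where
        open ≤-Reasoning
        blocked : ∀ x → suc x ≤ n' → x ≡ j ⊎ bitAt X x ≡ true → shortEdge x ∈ᴱ (shortEdge j ∷ failures X)
        blocked x _ (inj₁ refl) = here (inj₁ (refl , refl))
        blocked x _ (inj₂ Xx)   = there (failedFrom-complete X 0 x Xx)

    -- A subgraph containing a replacement path for X is not disjoint from the
    -- failures of any pattern Y separated from X: it contains the free edge j.
    separated-conflict : ∀ (H : Subgraph graph) {P Y} →
      IsReplacementPath graph (vertex 0) (vertex m) (failures X) P → All (InSub H) (edges P) →
      All (λ e → ¬ InSub H e) (failures Y) → Separates X Y → ⊥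
    separated-conflict H {P} {Y} P-replacement P⊆H H∩F_Y=∅ (j , free , Yj) =
      replacement-usesFree P-replacement free
        (avoids-outside H P P⊆H (disjoint-misses H H∩F_Y=∅ (failedFrom-complete Y 0 j Yj))
                        (proj₁ P-replacement))

module Counting (n' L f : ℕ) (𝒢 : List (Subgraph (SkipPath.graph n')))
                (covering : IsRPCovering (SkipPath.graph n') L f 𝒢) where
  open SkipPath n'

  module _ {a r : ℕ} (fits : a + r ≤ n') (a≤L : a ≤ L) (r≤f : r ≤ f) where

    word : Fin (a C r) → List Bool
    word = enumerate a r

    pattern-length : ∀ i → length (spread (word i)) ≡ a + r
    pattern-length i = trans (spread-length (word i))
                             (cong₂ _+_ (enumerate-length a r i) (enumerate-ones a r i))

    module Pat (i : Fin (a C r)) = Pattern (word i) (pattern-length i) fits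

    Answer : Fin (a C r) → Set₁
    Answer i = ∃[ P ] (IsReplacementPath graph (vertex 0) (vertex (a + r)) (failures (Pat.X i)) P ×
                       len P ≤ L × Any (λ H → Covers H (failures (Pat.X i)) P) 𝒢)

    answer : ∀ i → Answer i
    answer i = covering (vertex 0) (vertex (a + r)) (failures (Pat.X i))
      (failedFrom-adjacent (Pat.X i) 0 (Pat.X≤n i))
      (subst (_≤ f) (sym failures-count) r≤f)
      (Pat.canonical i , Pat.canonical-replacement i ,
       subst (_≤ L) (sym (trans (followPath-len (word i) 0 (a + r) _ fits) (enumerate-length a r i))) a≤L)
      where
        failures-count : length (failures (Pat.X i)) ≡ r
        failures-count = trans (failedFrom-count (Pat.X i) 0)
                               (trans (spread-ones (word i)) (enumerate-ones a r i))

    chosen : Fin (a C r) → Fin (length 𝒢)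
    chosen i = Any.index (proj₂ (proj₂ (proj₂ (answer i))))

    chosen-covers : ∀ i → Covers (lookup 𝒢 (chosen i)) (failures (Pat.X i)) (proj₁ (answer i))
    chosen-covers i = lookup-index (proj₂ (proj₂ (proj₂ (answer i))))

    shared-conflict : ∀ i i′ → chosen i ≡ chosen i′ → Separates (Pat.X i) (Pat.X i′) → ⊥
    shared-conflict i i′ same separated =
      Pat.separated-conflict i (lookup 𝒢 (chosen i)) {Y = Pat.X i′} (proj₁ (proj₂ (answer i)))
        (proj₁ (chosen-covers i))
        (subst (λ k → All (λ e → ¬ InSub (lookup 𝒢 k) e) (failures (Pat.X i′))) (sym same)
               (proj₂ (chosen-covers i′)))
        separated

    chosen-injective : ∀ {i i′} → chosen i ≡ chosen i′ → i ≡ i′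
    chosen-injective {i} {i′} same with ≡-dec Bool._≟_ (word i) (word i′)
    ... | yes same-word = enumerate-injective a r same-word
    ... | no  different-words with spread-separates (word i) (word i′)
                             (trans (enumerate-length a r i) (sym (enumerate-length a r i′))) different-words
    ...   | inj₁ separated = ⊥-elim (shared-conflict i i′ same separated)
    ...   | inj₂ separated = ⊥-elim (shared-conflict i′ i (sym same) separated)

  covering-size : ∀ {a r} → a + r ≤ n' → a ≤ L → r ≤ f → a C r ≤ length 𝒢
  covering-size fits a≤L r≤f = injective⇒≤ (chosen-injective fits a≤L r≤f)

drop-power : ∀ n L f → 1 ≤ L → f ≤ L → L ^ suc f ≤ n * f ^ suc f → L ^ f ≤ n * f ^ f
drop-power n L@(suc _) f _ f≤L hyp = *-cancelˡ-≤ L (begin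
  L * L ^ f          ≤⟨ hyp ⟩
  n * (f * f ^ f)    ≤⟨ *-monoʳ-≤ n (*-monoˡ-≤ (f ^ f) f≤L) ⟩
  n * (L * f ^ f)    ≡⟨ *-leftComm n L (f ^ f) ⟩
  L * (n * f ^ f)    ∎)
  where open ≤-Reasoning

module Conclusion (n' L f ℓ : ℕ) (count : ∀ {a r} → a + r ≤ n' → a ≤ L → r ≤ f → a C r ≤ ℓ) where

  -- The empty failure set already needs one subgraph.
  ℓ-positive : 1 ≤ ℓ
  ℓ-positive = count {0} {0} z≤n z≤n z≤n

  -- Patterns with a single failure: ℓ ≥ a for every a ≤ L with a + 1 ≤ n'.
  ℓ-linear : 1 ≤ f → ∀ {a} → a + 1 ≤ n' → a ≤ L → a ≤ ℓ
  ℓ-linear 1≤f {a} fits a≤L = subst (_≤ ℓ) (nC1≡n a) (count fits a≤L 1≤f)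

  ≤3* : ∀ x → x ≤ 3 * x
  ≤3* x = m≤m+n x (x + (x + 0))

  bound-f>L : L < f → L ^ f ≤ ℓ * f ^ f
  bound-f>L L<f = ≤-trans (^-monoˡ-≤ f (<⇒≤ L<f)) (subst (_≤ ℓ * f ^ f) (*-identityˡ (f ^ f)) (*-monoˡ-≤ (f ^ f) ℓ-positive))

  bound-fits : f ≤ L → L + f ≤ n' → L ^ f ≤ ℓ * f ^ f
  bound-fits f≤L fits =
    ≤-trans (binomial-lowerBound L f f≤L) (*-monoˡ-≤ (f ^ f) (count fits ≤-refl ≤-refl))

  -- If it does not fit, then n ≤ L + f ≤ 2L, and single-failure patterns
  -- show n ≤ 3ℓ.
  n≤3ℓ : 1 ≤ f → f ≤ L → suc n' ≤ L + f → suc n' ≤ 3 * ℓ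
  n≤3ℓ 1≤f f≤L n≤L+f = vertices≤3ℓ n' n≤L+f ≤-refl
    where
      open ≤-Reasoning
      vertices≤3ℓ : ∀ k → suc k ≤ L + f → k ≤ n' → suc k ≤ 3 * ℓ
      vertices≤3ℓ zero          _ _ = ≤-trans ℓ-positive (≤3* ℓ)
      vertices≤3ℓ (suc zero)    _ _ = ≤-trans (s≤s (s≤s z≤n)) (*-monoʳ-≤ 3 ℓ-positive)
      vertices≤3ℓ (suc (suc k)) k+3≤L+f k+2≤n with suc k ≤? L
      ... | yes k+1≤L = begin
        3 + k        ≤⟨ +-monoʳ-≤ 3 (≤3* k) ⟩
        3 + 3 * k    ≡⟨ sym (*-suc 3 k) ⟩
        3 * suc k    ≤⟨ *-monoʳ-≤ 3 (ℓ-linear 1≤f (subst (_≤ n') (+-comm 1 (suc k)) k+2≤n) k+1≤L) ⟩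
        3 * ℓ        ∎
      ... | no  k+1≰L = begin
        3 + k        ≤⟨ k+3≤L+f ⟩
        L + f        ≤⟨ +-monoʳ-≤ L (≤-trans f≤L (m≤m+n L (L + 0))) ⟩
        3 * L        ≤⟨ *-monoʳ-≤ 3 (ℓ-linear 1≤f L+1≤n ≤-refl) ⟩
        3 * ℓ        ∎
        where
          L+1≤n : L + 1 ≤ n'
          L+1≤n = ≤-trans (≤-reflexive (+-comm L 1)) (≤-trans (s≤s (≤-trans (≤-pred (≰⇒> k+1≰L)) (n≤1+n k))) k+2≤n)

  bound : 1 ≤ L → 1 ≤ f → L ^ suc f ≤ suc n' * f ^ suc f → L ^ f ≤ 3 * (ℓ * f ^ f)
  bound 1≤L 1≤f hyp with f ≤? L
  ... | no  f≰L = ≤-trans (bound-f>L (≰⇒> f≰L)) (≤3* (ℓ * f ^ f))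
  ... | yes f≤L with L + f ≤? n'
  ...   | yes fits     = ≤-trans (bound-fits f≤L fits) (≤3* (ℓ * f ^ f))
  ...   | no  too-long = begin
    L ^ f            ≤⟨ drop-power (suc n') L f 1≤L f≤L hyp ⟩
    suc n' * f ^ f   ≤⟨ *-monoˡ-≤ (f ^ f) (n≤3ℓ 1≤f f≤L (≰⇒> too-long)) ⟩
    3 * ℓ * f ^ f    ≡⟨ *-assoc 3 ℓ (f ^ f) ⟩
    3 * (ℓ * f ^ f)  ∎
    where open ≤-Reasoning

theorem1p3 : ∃[ c ] (1 ≤ c ×
               (∀ (n L f : ℕ) → 1 ≤ n → 1 ≤ L → 1 ≤ f →
                 L ^ suc f ≤ n * f ^ suc f →
                 Σ (WGraph n) λ G →
                   ∀ (𝒢 : List (Subgraph G)) → IsRPCovering G L f 𝒢 →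
                     L ^ f ≤ c * (length 𝒢 * f ^ f)))
theorem1p3 = 3 , s≤s z≤n , instance-bound
  where
    instance-bound : ∀ (n L f : ℕ) → 1 ≤ n → 1 ≤ L → 1 ≤ f → L ^ suc f ≤ n * f ^ suc f →
                     Σ (WGraph n) λ G → ∀ (𝒢 : List (Subgraph G)) → IsRPCovering G L f 𝒢 →
                       L ^ f ≤ 3 * (length 𝒢 * f ^ f)
    instance-bound (suc n') L f _ 1≤L 1≤f hyp = SkipPath.graph n' , λ 𝒢 covering →
      Conclusion.bound n' L f (length 𝒢) (Counting.covering-size n' L f 𝒢 covering) 1≤L 1≤f hyp
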